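{- Let $q$ be a prime power and let $\mathcal{C}$ be a subspace code in $\mathcal{P}(\mathbb{F}_q^7)$ with minimum distance $4$. Then $x_2+x_3\le (q^2-q+1)\begin{bmatrix}7\\1\end{bmatrix}_q$, with equality only if $x_2=0$.
   Context: $\begin{bmatrix}n\\1\end{bmatrix}_q=\frac{q^n-1}{q-1}$. $\mathcal{P}(\mathbb{F}_q^7)$ is the set of all subspaces of $\mathbb{F}_q^7$ with the subspace metric $d_s(U,W)=\dim(U+W)-\dim(U\cap W)$; a subspace code is a subset $\mathcal{C}$, and minimum distance $4$ means $d_s(U,W)\ge 4$ for all distinct $U,W\in\mathcal{C}$. $x_i$ denotes the number of $i$-dimensional subspaces in $\mathcal{C}$. -}

module Defs where

open import Level using (0ℓ)
open import Data.Nat as ℕ using (ℕ; zero; suc; _≤_; _^_)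
open import Data.Nat.Primality using (Prime)
open import Data.Fin using (Fin)
open import Data.Fin.Properties using () renaming (_≟_ to _≟ᶠ_)
open import Data.Vec using (Vec; []; _∷_; zipWith; replicate; map)
open import Data.List using (List; length; filter; allFin)
open import Data.Product using (Σ; ∃; _×_; _,_)
open import Relation.Nullary using (¬_)
open import Relation.Binary.PropositionalEquality using (_≡_)
open import Function.Bundles using (_↔_; _⇔_)
open import Algebra.Structures using (IsCommutativeRing)

IsPrimePower : ℕ → Set
IsPrimePower q = Σ ℕ λ p → Σ ℕ λ k → Prime p × (1 ≤ k) × (q ≡ p ^ k)

record FiniteField (q : ℕ) : Set₁ where
  field
    Carrier : Set
    _+_ _*_ : Carrier → Carrier → Carrier
    -_      : Carrier → Carrier
    0# 1#   : Carrier
    isCommutativeRing : IsCommutativeRing _≡_ _+_ _*_ -_ 0# 1#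
    0≢1     : ¬ (0# ≡ 1#)
    inverse : ∀ x → ¬ (x ≡ 0#) → Σ Carrier λ y → x * y ≡ 1#
    enumeration : Fin q ↔ Carrier

module Subspaces {q : ℕ} (𝔽 : FiniteField q) where
  open FiniteField 𝔽

  V : Set
  V = Vec Carrier 7

  _⊕_ : V → V → V
  _⊕_ = zipWith _+_

  _·_ : Carrier → V → V
  a · v = map (a *_) v

  𝟎 : V
  𝟎 = replicate 7 0#

  record Subspace : Set₁ where
    field
      mem     : V → Set
      zero∈   : mem 𝟎
      +-closed : ∀ {u v} → mem u → mem v → mem (u ⊕ v)
      ·-closed : ∀ a {v} → mem v → mem (a · v)
  open Subspace public

  _∩_ : Subspace → Subspace → (V → Set)
  (U ∩ W) v = mem U v × mem W v

  _+ˢ_ : Subspace → Subspace → (V → Set)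
  (U +ˢ W) v = Σ V λ u → Σ V λ w → mem U u × mem W w × (v ≡ u ⊕ w)

  lincomb : ∀ {d} → Vec Carrier d → Vec V d → V
  lincomb []       []       = 𝟎
  lincomb (c ∷ cs) (b ∷ bs) = (c · b) ⊕ lincomb cs bs

  LinIndep : ∀ {d} → Vec V d → Set
  LinIndep {d} b = ∀ c → lincomb c b ≡ 𝟎 → c ≡ replicate d 0#

  HasDimP : (V → Set) → ℕ → Set
  HasDimP P d = Σ (Vec V d) λ b → LinIndep b × (∀ v → P v ⇔ (Σ (Vec Carrier d) λ c → v ≡ lincomb c b))

  HasDim : Subspace → ℕ → Set
  HasDim U = HasDimP (mem U)

  DistAtLeast : ℕ → Subspace → Subspace → Set
  DistAtLeast δ U W = Σ ℕ λ a → Σ ℕ λ b → HasDimP (U +ˢ W) a × HasDimP (U ∩ W) b × (δ ≤ a ℕ.∸ b)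

  record Codeword : Set₁ where
    field
      space  : Subspace
      dim    : ℕ
      hasDim : HasDim space dim
  open Codeword public

  MinDist : ∀ {n} → (Fin n → Codeword) → ℕ → Set
  MinDist {n} C δ = ∀ (i j : Fin n) → ¬ (i ≡ j) → DistAtLeast δ (space (C i)) (space (C j))

  count : ∀ {n} → (Fin n → Codeword) → ℕ → ℕ
  count {n} C k = length (filter (λ i → dim (C i) ℕ.≟ k) (allFin n))

-- Gaussian binomial [n choose 1]_q = (q^n - 1)/(q - 1) = Σ_{i<n} q^i
gauss1 : ℕ → ℕ → ℕ
gauss1 zero    q = 0
gauss1 (suc n) q = q ^ n ℕ.+ gauss1 n q

module Submission where

-- Idea: double count flags, i.e. ordered pairs (u, v) of vectors with u ≠ 0 and
-- v ∉ ⟨u⟩; there are (q⁷−1)(q⁷−q) of them. Charge to each 2-dimensional codeword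
-- the flags whose u lies in it, (q²−1)(q⁷−q) many, and to each 3-dimensional
-- codeword the flags lying inside it, (q³−1)(q³−q) many. Two codewords charged
-- with the same flag share the nonzero vector u, and two solids even share the
-- independent pair u, v; by the Steinitz exchange lemma their subspace distance
-- is then below 4. Hence (q²−1)(q⁷−q)·x₂ + (q³−1)(q³−q)·x₃ ≤ (q⁷−1)(q⁷−q), and
-- since (q⁷−1)(q⁷−q) = (q³−1)(q³−q)(q²−q+1)[7]_q while (q²−1)(q⁷−q) is strictly
-- larger than (q³−1)(q³−q), the bound and its equality case follow.

open import Defs
open import Data.Nat as ℕ using (ℕ; zero; suc; _+_; _*_; _∸_; _^_; _≤_; _<_; _≤?_; z≤n; s≤s; >-nonZero; >-nonZero⁻¹)
import Data.Nat.Properties as ℕₚ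
open import Data.Nat.Tactic.RingSolver using (solve-∀)
open import Data.Nat.Primality using (prime⇒nonZero; prime⇒nonTrivial)
open import Data.Fin as Fin using (Fin)
import Data.Fin.Properties as Finₚ
open import Data.Vec as Vec using (Vec; []; _∷_; zipWith; replicate; map)
import Data.Vec.Properties as Vecₚ
open import Data.List as List using (List; []; _∷_; _++_; concatMap; allFin; length; filter)
import Data.List.Properties as Listₚ
open import Data.List.Properties using (map-tabulate)
open import Data.List.Membership.Propositional using (_∈_)
open import Data.List.Membership.Propositional.Properties using (∈-++⁺ˡ; ∈-++⁺ʳ; ∈-++⁻)
open import Data.List.Relation.Unary.Any using (Any; here; there; any?)
open import Data.Product using (Σ; _×_; _,_; proj₁; proj₂)
open import Data.Sum using (_⊎_; inj₁; inj₂; [_,_]′)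
open import Data.Unit using (⊤; tt)
open import Data.Empty using (⊥; ⊥-elim)
open import Relation.Nullary using (¬_; Dec; yes; no; ¬?)
open import Relation.Nullary.Decidable using (_×-dec_)
open import Relation.Unary using (Decidable)
open import Relation.Binary.Definitions using (DecidableEquality)
open import Relation.Binary.PropositionalEquality
open import Function.Bundles using (_↔_; Inverse; Equivalence)
open import Algebra.Structures using (IsCommutativeRing)

module FiniteSums where

  ∑ : {A : Set} → List A → (A → ℕ) → ℕ
  ∑ []       f = 0
  ∑ (x ∷ xs) f = f x + ∑ xs f

  𝟙 : {P : Set} → Dec P → ℕ
  𝟙 (yes _) = 1
  𝟙 (no _)  = 0

  𝟙-yes : {P : Set} (p : Dec P) → P → 𝟙 p ≡ 1
  𝟙-yes (yes _) _  = refl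
  𝟙-yes (no ¬x) x = ⊥-elim (¬x x)

  𝟙-no : {P : Set} (p : Dec P) → ¬ P → 𝟙 p ≡ 0
  𝟙-no (yes x) ¬x = ⊥-elim (¬x x)
  𝟙-no (no _)  _  = refl

  𝟙-positive : {P : Set} (p : Dec P) → 1 ≤ 𝟙 p → P
  𝟙-positive (yes x) _ = x

  𝟙*≤ : {P : Set} (p : Dec P) (x : ℕ) → 𝟙 p * x ≤ x
  𝟙*≤ (yes _) x = ℕₚ.≤-reflexive (ℕₚ.+-identityʳ x)
  𝟙*≤ (no _)  x = z≤n

  𝟙*-positive : {P : Set} (p : Dec P) (x : ℕ) → 1 ≤ 𝟙 p * x → P × 1 ≤ x
  𝟙*-positive (yes p) x 1≤x+0 = p , ℕₚ.≤-trans 1≤x+0 (𝟙*≤ (yes p) x)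

  𝟙-cong : {P Q : Set} → (P → Q) → (Q → P) → (p : Dec P) (q : Dec Q) → 𝟙 p ≡ 𝟙 q
  𝟙-cong f g (yes _) (yes _) = refl
  𝟙-cong f g (no _)  (no _)  = refl
  𝟙-cong f g (yes x) (no ¬y) = ⊥-elim (¬y (f x))
  𝟙-cong f g (no ¬x) (yes y) = ⊥-elim (¬x (g y))

  𝟙-× : {P Q : Set} (p : Dec P) (q : Dec Q) → 𝟙 (p ×-dec q) ≡ 𝟙 p * 𝟙 q
  𝟙-× (yes _) (yes _) = refl
  𝟙-× (yes _) (no _)  = refl
  𝟙-× (no _)  (yes _) = refl
  𝟙-× (no _)  (no _)  = refl

  module _ {A : Set} where

    ∑-cong : (xs : List A) {f g : A → ℕ} → (∀ x → f x ≡ g x) → ∑ xs f ≡ ∑ xs g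
    ∑-cong []       e = refl
    ∑-cong (x ∷ xs) e = cong₂ _+_ (e x) (∑-cong xs e)

    ∑-mono : (xs : List A) {f g : A → ℕ} → (∀ x → f x ≤ g x) → ∑ xs f ≤ ∑ xs g
    ∑-mono []       e = z≤n
    ∑-mono (x ∷ xs) e = ℕₚ.+-mono-≤ (e x) (∑-mono xs e)

    ∑-zero : (xs : List A) {f : A → ℕ} → (∀ x → f x ≡ 0) → ∑ xs f ≡ 0
    ∑-zero []       e = refl
    ∑-zero (x ∷ xs) e rewrite e x = ∑-zero xs e

    ∑-+ : (xs : List A) (f g : A → ℕ) → ∑ xs (λ x → f x + g x) ≡ ∑ xs f + ∑ xs g
    ∑-+ []       f g = refl
    ∑-+ (x ∷ xs) f g rewrite ∑-+ xs f g = interchange (f x) (g x) _ _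
      where
      interchange : ∀ a b c d → (a + b) + (c + d) ≡ (a + c) + (b + d)
      interchange = solve-∀

    ∑-*ʳ : (xs : List A) (f : A → ℕ) (k : ℕ) → ∑ xs (λ x → f x * k) ≡ ∑ xs f * k
    ∑-*ʳ []       f k = refl
    ∑-*ʳ (x ∷ xs) f k rewrite ∑-*ʳ xs f k = sym (ℕₚ.*-distribʳ-+ k (f x) (∑ xs f))

    ∑-*ˡ : (xs : List A) (f : A → ℕ) (k : ℕ) → ∑ xs (λ x → k * f x) ≡ k * ∑ xs f
    ∑-*ˡ xs f k = trans (∑-cong xs (λ x → ℕₚ.*-comm k (f x)))
                        (trans (∑-*ʳ xs f k) (ℕₚ.*-comm _ k))

    ∑-++ : (xs ys : List A) (f : A → ℕ) → ∑ (xs ++ ys) f ≡ ∑ xs f + ∑ ys f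
    ∑-++ []       ys f = refl
    ∑-++ (x ∷ xs) ys f rewrite ∑-++ xs ys f = sym (ℕₚ.+-assoc (f x) _ _)

    length-filter : {P : A → Set} (P? : Decidable P) (xs : List A) →
                    length (filter P? xs) ≡ ∑ xs (λ x → 𝟙 (P? x))
    length-filter P? [] = refl
    length-filter P? (x ∷ xs) with P? x
    ... | yes _ = cong suc (length-filter P? xs)
    ... | no _  = length-filter P? xs

  ∑-swap : {A B : Set} (xs : List A) (ys : List B) (f : A → B → ℕ) →
           ∑ xs (λ x → ∑ ys (f x)) ≡ ∑ ys (λ y → ∑ xs (λ x → f x y))
  ∑-swap []       ys f = sym (∑-zero ys (λ _ → refl))
  ∑-swap (x ∷ xs) ys f rewrite ∑-swap xs ys f = sym (∑-+ ys (f x) _)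

  ∑-map : {A B : Set} (g : A → B) (xs : List A) (f : B → ℕ) → ∑ (List.map g xs) f ≡ ∑ xs (λ x → f (g x))
  ∑-map g []       f = refl
  ∑-map g (x ∷ xs) f = cong (f (g x) +_) (∑-map g xs f)

  ∑-concatMap : {A B : Set} (g : A → List B) (xs : List A) (f : B → ℕ) →
                ∑ (concatMap g xs) f ≡ ∑ xs (λ x → ∑ (g x) f)
  ∑-concatMap g []       f = refl
  ∑-concatMap g (x ∷ xs) f = trans (∑-++ (g x) (concatMap g xs) f) (cong (∑ (g x) f +_) (∑-concatMap g xs f))

module Enumerations where
  open FiniteSums

  record Enum (A : Set) : Set where
    field
      _≟_   : DecidableEquality A
      elems : List A
      once  : ∀ x → ∑ elems (λ y → 𝟙 (y ≟ x)) ≡ 1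

    size : ℕ
    size = ∑ elems (λ _ → 1)

    ∑-δ : ∀ x (g : A → ℕ) → ∑ elems (λ y → 𝟙 (y ≟ x) * g y) ≡ g x
    ∑-δ x g = trans (∑-cong elems pointwise)
                    (trans (∑-*ʳ elems (λ y → 𝟙 (y ≟ x)) (g x))
                           (trans (cong (_* g x) (once x)) (ℕₚ.+-identityʳ (g x))))
      where
      pointwise : ∀ y → 𝟙 (y ≟ x) * g y ≡ 𝟙 (y ≟ x) * g x
      pointwise y with y ≟ x
      ... | yes refl = refl
      ... | no _     = refl

    ∈-elems : ∀ x → Any (_≡ x) elems
    ∈-elems x = occurs elems (once x)
      where
      occurs : ∀ xs → ∑ xs (λ y → 𝟙 (y ≟ x)) ≡ 1 → Any (_≡ x) xs
      occurs (y ∷ xs) e with y ≟ x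
      ... | yes y≡x = here y≡x
      ... | no _    = there (occurs xs e)

    ∃? : {P : A → Set} → Decidable P → Dec (Σ A P)
    ∃? {P} P? with any? P? elems
    ... | yes found = yes (witness found)
      where
      witness : ∀ {xs} → Any P xs → Σ A P
      witness (here p)  = _ , p
      witness (there a) = witness a
    ... | no none = no (λ { (x , px) → none (transport (∈-elems x) px) })
      where
      transport : ∀ {xs x} → Any (_≡ x) xs → P x → Any P xs
      transport (here refl) px = here px
      transport (there a)   px = there (transport a px)

    ∑-at-most-one : (f : A → ℕ) (c : ℕ) → (∀ x → f x ≤ c) → (∀ x y → 1 ≤ f x → 1 ≤ f y → x ≡ y) → ∑ elems f ≤ c
    ∑-at-most-one f c f≤c unique with ∃? (λ x → 1 ≤? f x)
    ... | yes (x₀ , 1≤fx₀) = begin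
      ∑ elems f                        ≤⟨ ∑-mono elems only-x₀ ⟩
      ∑ elems (λ y → 𝟙 (y ≟ x₀) * c)   ≡⟨ ∑-δ x₀ (λ _ → c) ⟩
      c ∎
      where
      open ℕₚ.≤-Reasoning
      only-x₀ : ∀ y → f y ≤ 𝟙 (y ≟ x₀) * c
      only-x₀ y with y ≟ x₀ | 1 ≤? f y
      ... | yes refl | _        = ℕₚ.≤-trans (f≤c y) (ℕₚ.≤-reflexive (sym (ℕₚ.+-identityʳ c)))
      ... | no y≢x₀  | yes 1≤fy = ⊥-elim (y≢x₀ (unique y x₀ 1≤fy 1≤fx₀))
      ... | no _     | no fy<1  = ℕₚ.≤-pred (ℕₚ.≰⇒> fy<1)
    ... | no none = ℕₚ.≤-trans (ℕₚ.≤-reflexive (∑-zero elems all-zero)) z≤n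
      where
      all-zero : ∀ x → f x ≡ 0
      all-zero x with 1 ≤? f x
      ... | yes 1≤fx = ⊥-elim (none (x , 1≤fx))
      ... | no fx<1  = ℕₚ.n≤0⇒n≡0 (ℕₚ.≤-pred (ℕₚ.≰⇒> fx<1))

  ∑-image : {A B : Set} (EA : Enum A) (EB : Enum B) (φ : B → A) →
            (∀ b b′ → φ b ≡ φ b′ → b ≡ b′) →
            (inImage? : ∀ a → Dec (Σ B λ b → a ≡ φ b)) (g : A → ℕ) →
            ∑ (Enum.elems EA) (λ a → 𝟙 (inImage? a) * g a) ≡ ∑ (Enum.elems EB) (λ b → g (φ b))
  ∑-image EA EB φ φ-inj inImage? g = sym (begin
      ∑ B.elems (λ b → g (φ b))
        ≡⟨ ∑-cong B.elems (λ b → sym (A.∑-δ (φ b) g)) ⟩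
      ∑ B.elems (λ b → ∑ A.elems (λ a → 𝟙 (a A.≟ φ b) * g a))
        ≡⟨ ∑-swap B.elems A.elems (λ b a → 𝟙 (a A.≟ φ b) * g a) ⟩
      ∑ A.elems (λ a → ∑ B.elems (λ b → 𝟙 (a A.≟ φ b) * g a))
        ≡⟨ ∑-cong A.elems (λ a → trans (∑-*ʳ B.elems _ (g a)) (cong (_* g a) (preimages a))) ⟩
      ∑ A.elems (λ a → 𝟙 (inImage? a) * g a) ∎)
    where
    open ≡-Reasoning
    module A = Enum EA
    module B = Enum EB
    preimages : ∀ a → ∑ B.elems (λ b → 𝟙 (a A.≟ φ b)) ≡ 𝟙 (inImage? a)
    preimages a with inImage? a
    ... | yes (b₀ , a≡φb₀) =
      trans (∑-cong B.elems (λ b → 𝟙-cong (λ a≡φb → φ-inj b b₀ (trans (sym a≡φb) a≡φb₀))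
                                           (λ b≡b₀ → trans a≡φb₀ (cong φ (sym b≡b₀)))
                                           (a A.≟ φ b) (b B.≟ b₀)))
            (B.once b₀)
    ... | no ∉image = ∑-zero B.elems (λ b → 𝟙-no (a A.≟ φ b) (λ a≡φb → ∉image (b , a≡φb)))

  ∑-allFin-suc : ∀ n (f : Fin (suc n) → ℕ) → ∑ (allFin (suc n)) f ≡ f Fin.zero + ∑ (allFin n) (λ j → f (Fin.suc j))
  ∑-allFin-suc n f = cong (f Fin.zero +_)
    (trans (cong (λ js → ∑ js f) (sym (map-tabulate (λ j → j) Fin.suc))) (∑-map Fin.suc (allFin n) f))

  allFin-once : ∀ n (i : Fin n) → ∑ (allFin n) (λ j → 𝟙 (j Finₚ.≟ i)) ≡ 1
  allFin-once (suc n) Fin.zero = trans (∑-allFin-suc n (λ j → 𝟙 (j Finₚ.≟ Fin.zero)))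
    (cong suc (∑-zero (allFin n) (λ j → 𝟙-no (Fin.suc j Finₚ.≟ Fin.zero) (λ ()))))
  allFin-once (suc n) (Fin.suc i) = trans (∑-allFin-suc n (λ j → 𝟙 (j Finₚ.≟ Fin.suc i)))
    (trans (∑-cong (allFin n) (λ j → 𝟙-cong Finₚ.suc-injective (cong Fin.suc) (Fin.suc j Finₚ.≟ Fin.suc i) (j Finₚ.≟ i)))
           (allFin-once n i))

  enumFin : ∀ n → Enum (Fin n)
  enumFin n = record { _≟_ = Finₚ._≟_ ; elems = allFin n ; once = allFin-once n }

  enumVia : ∀ {A : Set} n → Fin n ↔ A → Enum A
  enumVia {A} n e = record { _≟_ = _≟A_ ; elems = List.map to (allFin n) ; once = once }
    where
    open Inverse e using (to; from; strictlyInverseˡ; strictlyInverseʳ)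
    _≟A_ : DecidableEquality A
    x ≟A y with from x Finₚ.≟ from y
    ... | yes eq = yes (trans (sym (strictlyInverseˡ x)) (trans (cong to eq) (strictlyInverseˡ y)))
    ... | no ne  = no (λ eq → ne (cong from eq))
    once : ∀ x → ∑ (List.map to (allFin n)) (λ y → 𝟙 (y ≟A x)) ≡ 1
    once x = trans (∑-map to (allFin n) _)
      (trans (∑-cong (allFin n) (λ i → 𝟙-cong (λ eq → trans (sym (strictlyInverseʳ i)) (cong from eq))
                                               (λ eq → trans (cong to eq) (strictlyInverseˡ x))
                                               (to i ≟A x) (i Finₚ.≟ from x)))
             (allFin-once n (from x)))

  size-enumVia : ∀ {A : Set} n (e : Fin n ↔ A) → Enum.size (enumVia n e) ≡ n
  size-enumVia n e = trans (∑-map (Inverse.to e) (allFin n) (λ _ → 1)) (size-allFin n)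
    where
    size-allFin : ∀ n → ∑ (allFin n) (λ _ → 1) ≡ n
    size-allFin zero    = refl
    size-allFin (suc n) = trans (∑-allFin-suc n (λ _ → 1)) (cong suc (size-allFin n))

  module VecEnum {A : Set} (E : Enum A) where
    open Enum E using (elems; once; size) renaming (_≟_ to _≟A_)

    _≟V_ : ∀ {d} → DecidableEquality (Vec A d)
    _≟V_ = Vecₚ.≡-dec _≟A_

    vecs : ∀ d → List (Vec A d)
    vecs zero    = [] ∷ []
    vecs (suc d) = concatMap (λ a → List.map (a ∷_) (vecs d)) elems

    ∑-vecs : ∀ d (f : Vec A (suc d) → ℕ) → ∑ (vecs (suc d)) f ≡ ∑ elems (λ a → ∑ (vecs d) (λ w → f (a ∷ w)))
    ∑-vecs d f = trans (∑-concatMap _ elems f) (∑-cong elems (λ a → ∑-map (a ∷_) (vecs d) f))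

    𝟙-∷ : ∀ {d} a x (w y : Vec A d) → 𝟙 ((a ∷ w) ≟V (x ∷ y)) ≡ 𝟙 (a ≟A x) * 𝟙 (w ≟V y)
    𝟙-∷ a x w y = trans (𝟙-cong (λ { refl → refl , refl }) (λ { (refl , refl) → refl })
                                ((a ∷ w) ≟V (x ∷ y)) (a ≟A x ×-dec w ≟V y))
                        (𝟙-× (a ≟A x) (w ≟V y))

    vecs-once : ∀ {d} (x : Vec A d) → ∑ (vecs d) (λ y → 𝟙 (y ≟V x)) ≡ 1
    vecs-once []               = refl
    vecs-once {suc d} (x ∷ xs) = trans (∑-vecs d _)
      (trans (∑-cong elems (λ a → trans (∑-cong (vecs d) (λ w → 𝟙-∷ a x w xs))
                                 (trans (∑-*ˡ (vecs d) _ (𝟙 (a ≟A x))) (cong (𝟙 (a ≟A x) *_) (vecs-once xs)))))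
             (trans (∑-cong elems (λ a → ℕₚ.*-identityʳ _)) (once x)))

    enumVec : ∀ d → Enum (Vec A d)
    enumVec d = record { _≟_ = _≟V_ ; elems = vecs d ; once = vecs-once }

    size-enumVec : ∀ d → Enum.size (enumVec d) ≡ size ^ d
    size-enumVec zero    = refl
    size-enumVec (suc d) = trans (∑-vecs d _)
      (trans (∑-cong elems (λ _ → trans (size-enumVec d) (sym (ℕₚ.*-identityˡ _))))
             (∑-*ʳ elems (λ _ → 1) _))

-- Elementary arithmetic: the q-analogue identities behind the final bound.
module Arithmetic where
  open ℕₚ
  open ≡-Reasoning

  -- (m − 1)(1 + m + … + m^(k−1)) = m^k − 1, in truncated subtraction (also for m = 0)
  geometric-series : ∀ m k → (m ∸ 1) * gauss1 k m ≡ m ^ k ∸ 1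
  geometric-series zero    zero    = refl
  geometric-series zero    (suc k) = refl
  geometric-series (suc p) k       = cong (_∸ 1) (sym (power p k))
    where
    step : ∀ p G → (1 + p) * (1 + p * G) ≡ 1 + p * ((1 + p * G) + G)
    step = solve-∀
    power : ∀ p k → suc p ^ k ≡ 1 + p * gauss1 k (suc p)
    power p zero    = cong suc (sym (*-zeroʳ p))
    power p (suc k) = trans (cong (suc p *_) (power p k))
      (trans (step p (gauss1 k (suc p))) (cong (λ z → 1 + p * (z + gauss1 k (suc p))) (sym (power p k))))

  difference-of-squares : ∀ m → (m ∸ 1) * (m + 1) ≡ m * m ∸ 1
  difference-of-squares zero    = refl
  difference-of-squares (suc k) = expand k
    where
    expand : ∀ k → k * (suc k + 1) ≡ k + k * suc k
    expand = solve-∀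

  sum-of-cubes : ∀ m → (m + 1) * (m * m ∸ m + 1) ≡ m ^ 3 + 1
  sum-of-cubes zero    = refl
  sum-of-cubes (suc k) = trans (cong (λ z → (suc k + 1) * (z + 1)) (m+n∸m≡n (suc k) (k * suc k))) (expand k)
    where
    expand : ∀ k → ((1 + k) + 1) * (k * (1 + k) + 1) ≡ (1 + k) * ((1 + k) * ((1 + k) * 1)) + 1
    expand = solve-∀

  power-minus-base : ∀ q k → q ^ suc k ∸ q ≡ q * (q ^ k ∸ 1)
  power-minus-base q k = sym (trans (*-distribˡ-∸ q (q ^ k) 1) (cong (q * q ^ k ∸_) (*-identityʳ q)))

  square-minus-one : ∀ q → q ^ 2 ∸ 1 ≡ (q ∸ 1) * (q + 1)
  square-minus-one q = trans (cong (λ z → q * z ∸ 1) (*-identityʳ q)) (sym (difference-of-squares q))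

  sixth-power-minus-one : ∀ q → q ^ 6 ∸ 1 ≡ (q ^ 3 ∸ 1) * (q ^ 3 + 1)
  sixth-power-minus-one q = trans (cong (_∸ 1) (^-distribˡ-+-* q 3 3)) (sym (difference-of-squares (q ^ 3)))

  -- The quantities of the double count in F_q^7: the numbers of ordered pairs
  -- (u, v) with u ≠ 0 and v ∉ ⟨u⟩ in all of F_q^7, with u in a given plane, and
  -- with u, v in a given solid; and the bound of the theorem.
  pairs pairsPlane pairsSolid bound : ℕ → ℕ
  pairs      q = (q ^ 7 ∸ 1) * (q ^ 7 ∸ q)
  pairsPlane q = (q ^ 2 ∸ 1) * (q ^ 7 ∸ q)
  pairsSolid q = (q ^ 3 ∸ 1) * (q ^ 3 ∸ q)
  bound      q = (q * q ∸ q + 1) * gauss1 7 q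

  pairs≡pairsSolid*bound : ∀ q → pairs q ≡ pairsSolid q * bound q
  pairs≡pairsSolid*bound q = begin
    (q ^ 7 ∸ 1) * (q ^ 7 ∸ q)
      ≡⟨ cong₂ _*_ (sym (geometric-series q 7)) (power-minus-base q 6) ⟩
    ((q ∸ 1) * gauss1 7 q) * (q * (q ^ 6 ∸ 1))
      ≡⟨ cong (λ z → ((q ∸ 1) * gauss1 7 q) * (q * z))
              (trans (sixth-power-minus-one q) (cong ((q ^ 3 ∸ 1) *_) (sym (sum-of-cubes q)))) ⟩
    ((q ∸ 1) * gauss1 7 q) * (q * ((q ^ 3 ∸ 1) * ((q + 1) * (q * q ∸ q + 1))))
      ≡⟨ regroup (q ∸ 1) (gauss1 7 q) q (q ^ 3 ∸ 1) (q + 1) (q * q ∸ q + 1) ⟩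
    (q ^ 3 ∸ 1) * (q * ((q ∸ 1) * (q + 1))) * ((q * q ∸ q + 1) * gauss1 7 q)
      ≡⟨ cong (λ z → (q ^ 3 ∸ 1) * z * bound q)
              (trans (cong (q *_) (sym (square-minus-one q))) (sym (power-minus-base q 2))) ⟩
    pairsSolid q * bound q ∎
    where
    regroup : ∀ a g q b s c → (a * g) * (q * (b * (s * c))) ≡ b * (q * (a * s)) * (c * g)
    regroup = solve-∀

  pairsPlane≡pairsSolid*[q³+1] : ∀ q → pairsPlane q ≡ pairsSolid q * (q ^ 3 + 1)
  pairsPlane≡pairsSolid*[q³+1] q = begin
    (q ^ 2 ∸ 1) * (q ^ 7 ∸ q)
      ≡⟨ cong ((q ^ 2 ∸ 1) *_) (trans (power-minus-base q 6) (cong (q *_) (sixth-power-minus-one q))) ⟩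
    (q ^ 2 ∸ 1) * (q * ((q ^ 3 ∸ 1) * (q ^ 3 + 1)))
      ≡⟨ regroup (q ^ 2 ∸ 1) q (q ^ 3 ∸ 1) (q ^ 3 + 1) ⟩
    (q ^ 3 ∸ 1) * (q * (q ^ 2 ∸ 1)) * (q ^ 3 + 1)
      ≡⟨ cong (λ z → (q ^ 3 ∸ 1) * z * (q ^ 3 + 1)) (sym (power-minus-base q 2)) ⟩
    pairsSolid q * (q ^ 3 + 1) ∎
    where
    regroup : ∀ x q y s → x * (q * (y * s)) ≡ y * (q * x) * s
    regroup = solve-∀

  pairsSolid-positive : ∀ q → 2 ≤ q → 0 < pairsSolid q
  pairsSolid-positive q@(suc (suc r)) (s≤s (s≤s _)) = subst (0 <_) (sym factored) (>-nonZero⁻¹ _)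
    where
    factored : pairsSolid q ≡ (suc r * gauss1 3 q) * (q * (suc r * (q + 1)))
    factored = cong₂ _*_ (sym (geometric-series q 3))
                         (trans (power-minus-base q 2) (cong (q *_) (square-minus-one q)))

  weighted-bound : ∀ {a b x y B} → 0 < b → b < a → a * x + b * y ≤ b * B →
                   (x + y ≤ B) × (x + y ≡ B → x ≡ 0)
  weighted-bound {a} {b} {x} {y} {B} b>0 b<a total≤ = count≤ , equality x total≤
    where
    instance _ = >-nonZero b>0
    lighter : b * x + b * y ≤ a * x + b * y
    lighter = +-monoˡ-≤ (b * y) (*-monoˡ-≤ x (<⇒≤ b<a))
    count≤ : x + y ≤ B
    count≤ = *-cancelˡ-≤ b (subst (_≤ b * B) (sym (*-distribˡ-+ b x y)) (≤-trans lighter total≤))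
    equality : ∀ x → a * x + b * y ≤ b * B → x + y ≡ B → x ≡ 0
    equality zero    _      _  = refl
    equality (suc k) total≤ eq =
      ⊥-elim (<⇒≱ heavier (≤-trans total≤ (≤-reflexive (trans (cong (b *_) (sym eq)) (*-distribˡ-+ b (suc k) y)))))
      where
      heavier : b * suc k + b * y < a * suc k + b * y
      heavier = +-monoˡ-< (b * y) (*-monoˡ-< (suc k) b<a)

  pair-count-bound : ∀ q → 2 ≤ q → ∀ x y → pairsPlane q * x + pairsSolid q * y ≤ pairs q →
                     (x + y ≤ bound q) × (x + y ≡ bound q → x ≡ 0)
  pair-count-bound q q≥2 x y counted =
    weighted-bound solid>0 solid<plane (subst (pairsPlane q * x + pairsSolid q * y ≤_) (pairs≡pairsSolid*bound q) counted)
    where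
    solid>0 : 0 < pairsSolid q
    solid>0 = pairsSolid-positive q q≥2
    instance
      _ = >-nonZero solid>0
      _ = >-nonZero (≤-trans (s≤s z≤n) q≥2)
    solid<plane : pairsSolid q < pairsPlane q
    solid<plane = subst (pairsSolid q <_) (sym (pairsPlane≡pairsSolid*[q³+1] q))
                        (m<m*n (pairsSolid q) (q ^ 3 + 1) (+-monoˡ-< 1 (>-nonZero⁻¹ (q ^ 3) {{m^n≢0 q 3}})))

-- Linear algebra in F_q^7: spans, the Steinitz exchange lemma, and the
-- dimension bound it gives for two subspaces sharing independent vectors.
module LinearAlgebra {q : ℕ} (𝔽 : FiniteField q) where
  open FiniteField 𝔽 renaming (_+_ to _+ᶠ_; _*_ to _*ᶠ_; -_ to -ᶠ_)
  open IsCommutativeRing isCommutativeRing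
    using (+-assoc; +-comm; +-identityˡ; +-identityʳ; -‿inverseʳ; *-assoc; *-comm; *-identityˡ;
           distribˡ; distribʳ; zeroˡ; zeroʳ)
  open Subspaces 𝔽
  open Enumerations
  open ≡-Reasoning

  fieldEnum : Enum Carrier
  fieldEnum = enumVia q enumeration

  open Enum fieldEnum public using () renaming (_≟_ to _≟ᶠ_)

  ⊕-assoc : ∀ u v w → (u ⊕ v) ⊕ w ≡ u ⊕ (v ⊕ w)
  ⊕-assoc = Vecₚ.zipWith-assoc +-assoc

  ⊕-comm : ∀ u v → u ⊕ v ≡ v ⊕ u
  ⊕-comm = Vecₚ.zipWith-comm +-comm

  ⊕-identityˡ : ∀ u → 𝟎 ⊕ u ≡ u
  ⊕-identityˡ = Vecₚ.zipWith-identityˡ +-identityˡ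

  ⊕-identityʳ : ∀ u → u ⊕ 𝟎 ≡ u
  ⊕-identityʳ = Vecₚ.zipWith-identityʳ +-identityʳ

  ·-distrib-⊕ : ∀ {n} a (u v : Vec Carrier n) → map (a *ᶠ_) (zipWith _+ᶠ_ u v) ≡ zipWith _+ᶠ_ (map (a *ᶠ_) u) (map (a *ᶠ_) v)
  ·-distrib-⊕ a []      []      = refl
  ·-distrib-⊕ a (x ∷ u) (y ∷ v) = cong₂ _∷_ (distribˡ a x y) (·-distrib-⊕ a u v)

  +-distrib-· : ∀ {n} a b (u : Vec Carrier n) → map ((a +ᶠ b) *ᶠ_) u ≡ zipWith _+ᶠ_ (map (a *ᶠ_) u) (map (b *ᶠ_) u)
  +-distrib-· a b []      = refl
  +-distrib-· a b (x ∷ u) = cong₂ _∷_ (distribʳ x a b) (+-distrib-· a b u)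

  *-assoc-· : ∀ {n} a b (u : Vec Carrier n) → map ((a *ᶠ b) *ᶠ_) u ≡ map (a *ᶠ_) (map (b *ᶠ_) u)
  *-assoc-· a b []      = refl
  *-assoc-· a b (x ∷ u) = cong₂ _∷_ (*-assoc a b x) (*-assoc-· a b u)

  1-· : ∀ {n} (u : Vec Carrier n) → map (1# *ᶠ_) u ≡ u
  1-· []      = refl
  1-· (x ∷ u) = cong₂ _∷_ (*-identityˡ x) (1-· u)

  0-· : ∀ {n} (u : Vec Carrier n) → map (0# *ᶠ_) u ≡ replicate n 0#
  0-· []      = refl
  0-· (x ∷ u) = cong₂ _∷_ (zeroˡ x) (0-· u)

  ·-𝟎 : ∀ {n} a → map (a *ᶠ_) (replicate n 0#) ≡ replicate n 0#
  ·-𝟎 {n} a = trans (Vecₚ.map-replicate (a *ᶠ_) 0# n) (cong (replicate n) (zeroʳ a))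

  ⊕-cancel : ∀ {n} (u : Vec Carrier n) → zipWith _+ᶠ_ u (map ((-ᶠ 1#) *ᶠ_) u) ≡ replicate n 0#
  ⊕-cancel []      = refl
  ⊕-cancel (x ∷ u) = cong₂ _∷_ cancel (⊕-cancel u)
    where
    cancel : x +ᶠ ((-ᶠ 1#) *ᶠ x) ≡ 0#
    cancel = begin
      x +ᶠ ((-ᶠ 1#) *ᶠ x)        ≡⟨ cong (_+ᶠ ((-ᶠ 1#) *ᶠ x)) (sym (*-identityˡ x)) ⟩
      (1# *ᶠ x) +ᶠ ((-ᶠ 1#) *ᶠ x) ≡⟨ sym (distribʳ x 1# (-ᶠ 1#)) ⟩
      (1# +ᶠ (-ᶠ 1#)) *ᶠ x        ≡⟨ cong (_*ᶠ x) (-‿inverseʳ 1#) ⟩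
      0# *ᶠ x                     ≡⟨ zeroˡ x ⟩
      0# ∎

  ⊕-interchange : ∀ a b c d → (a ⊕ b) ⊕ (c ⊕ d) ≡ (a ⊕ c) ⊕ (b ⊕ d)
  ⊕-interchange a b c d = begin
    (a ⊕ b) ⊕ (c ⊕ d) ≡⟨ ⊕-assoc a b (c ⊕ d) ⟩
    a ⊕ (b ⊕ (c ⊕ d)) ≡⟨ cong (a ⊕_) (sym (⊕-assoc b c d)) ⟩
    a ⊕ ((b ⊕ c) ⊕ d) ≡⟨ cong (λ z → a ⊕ (z ⊕ d)) (⊕-comm b c) ⟩
    a ⊕ ((c ⊕ b) ⊕ d) ≡⟨ cong (a ⊕_) (⊕-assoc c b d) ⟩
    a ⊕ (c ⊕ (b ⊕ d)) ≡⟨ sym (⊕-assoc a c (b ⊕ d)) ⟩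
    (a ⊕ c) ⊕ (b ⊕ d) ∎

  scalar-kills⇒zero : ∀ a u → a · u ≡ 𝟎 → ¬ u ≡ 𝟎 → a ≡ 0#
  scalar-kills⇒zero a u au≡𝟎 u≢𝟎 with a ≟ᶠ 0#
  ... | yes a≡0 = a≡0
  ... | no a≢0 with inverse a a≢0
  ...   | a⁻¹ , aa⁻¹≡1 = ⊥-elim (u≢𝟎 (begin
          u              ≡⟨ sym (1-· u) ⟩
          1# · u         ≡⟨ cong (_· u) (sym (trans (*-comm a⁻¹ a) aa⁻¹≡1)) ⟩
          (a⁻¹ *ᶠ a) · u ≡⟨ *-assoc-· a⁻¹ a u ⟩
          a⁻¹ · (a · u)  ≡⟨ cong (a⁻¹ ·_) au≡𝟎 ⟩
          a⁻¹ · 𝟎        ≡⟨ ·-𝟎 a⁻¹ ⟩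
          𝟎 ∎))

  difference-zero : ∀ {n} (u v : Vec Carrier n) → zipWith _+ᶠ_ u (map ((-ᶠ 1#) *ᶠ_) v) ≡ replicate n 0# → u ≡ v
  difference-zero {n} u v u-v≡0 = begin
    u                                 ≡⟨ sym (Vecₚ.zipWith-identityʳ +-identityʳ u) ⟩
    u ⊞ replicate n 0#                ≡⟨ cong (u ⊞_) (sym (trans (Vecₚ.zipWith-comm +-comm _ v) (⊕-cancel v))) ⟩
    u ⊞ (map ((-ᶠ 1#) *ᶠ_) v ⊞ v)     ≡⟨ sym (Vecₚ.zipWith-assoc +-assoc u _ v) ⟩
    (u ⊞ map ((-ᶠ 1#) *ᶠ_) v) ⊞ v     ≡⟨ cong (_⊞ v) u-v≡0 ⟩
    replicate n 0# ⊞ v                ≡⟨ Vecₚ.zipWith-identityˡ +-identityˡ v ⟩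
    v ∎
    where
    _⊞_ : Vec Carrier n → Vec Carrier n → Vec Carrier n
    _⊞_ = zipWith _+ᶠ_

  lincomb-zero : ∀ {d} (b : Vec V d) → lincomb (replicate d 0#) b ≡ 𝟎
  lincomb-zero []      = refl
  lincomb-zero (x ∷ b) = trans (cong₂ _⊕_ (0-· x) (lincomb-zero b)) (⊕-identityʳ 𝟎)

  lincomb-+ : ∀ {d} (c c′ : Vec Carrier d) (b : Vec V d) →
              lincomb (zipWith _+ᶠ_ c c′) b ≡ lincomb c b ⊕ lincomb c′ b
  lincomb-+ []      []        []      = sym (⊕-identityʳ 𝟎)
  lincomb-+ (a ∷ c) (a′ ∷ c′) (x ∷ b) =
    trans (cong₂ _⊕_ (+-distrib-· a a′ x) (lincomb-+ c c′ b)) (⊕-interchange _ _ _ _)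

  lincomb-· : ∀ {d} a (c : Vec Carrier d) (b : Vec V d) → lincomb (map (a *ᶠ_) c) b ≡ a · lincomb c b
  lincomb-· a []       []      = sym (·-𝟎 a)
  lincomb-· a (a′ ∷ c) (x ∷ b) =
    trans (cong₂ _⊕_ (*-assoc-· a a′ x) (lincomb-· a c b)) (sym (·-distrib-⊕ a _ _))

  lincomb-injective : ∀ {d} (b : Vec V d) → LinIndep b → ∀ c c′ → lincomb c b ≡ lincomb c′ b → c ≡ c′
  lincomb-injective b independent c c′ same = difference-zero c c′ (independent _ (begin
    lincomb (zipWith _+ᶠ_ c (map ((-ᶠ 1#) *ᶠ_) c′)) b ≡⟨ lincomb-+ c _ b ⟩
    lincomb c b ⊕ lincomb (map ((-ᶠ 1#) *ᶠ_) c′) b   ≡⟨ cong₂ _⊕_ same (lincomb-· _ c′ b) ⟩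
    lincomb c′ b ⊕ ((-ᶠ 1#) · lincomb c′ b)         ≡⟨ ⊕-cancel _ ⟩
    𝟎 ∎))

  data Span (S : List V) : V → Set where
    generator : ∀ {v} → v ∈ S → Span S v
    𝟎∈        : Span S 𝟎
    ⊕∈        : ∀ {u v} → Span S u → Span S v → Span S (u ⊕ v)
    ·∈        : ∀ a {v} → Span S v → Span S (a · v)

  span-trans : ∀ {S T v} → (∀ {x} → x ∈ S → Span T x) → Span S v → Span T v
  span-trans f (generator m) = f m
  span-trans f 𝟎∈            = 𝟎∈
  span-trans f (⊕∈ p r)      = ⊕∈ (span-trans f p) (span-trans f r)
  span-trans f (·∈ a p)      = ·∈ a (span-trans f p)

  span-mono : ∀ {S T v} → (∀ {x} → x ∈ S → x ∈ T) → Span S v → Span T v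
  span-mono f = span-trans (λ m → generator (f m))

  span-[] : ∀ {v} → Span [] v → v ≡ 𝟎
  span-[] 𝟎∈       = refl
  span-[] (⊕∈ p r) = trans (cong₂ _⊕_ (span-[] p) (span-[] r)) (⊕-identityˡ 𝟎)
  span-[] (·∈ a p) = trans (cong (a ·_) (span-[] p)) (·-𝟎 a)

  span-∷ : ∀ {r T v} → Span (r ∷ T) v → Σ Carrier λ β → Σ V λ s → Span T s × (v ≡ (β · r) ⊕ s)
  span-∷ {r} (generator (here refl)) = 1# , 𝟎 , 𝟎∈ , sym (trans (⊕-identityʳ _) (1-· r))
  span-∷ {r} {v = v} (generator (there m)) =
    0# , v , generator m , sym (trans (cong (_⊕ v) (0-· r)) (⊕-identityˡ v))
  span-∷ {r} 𝟎∈ = 0# , 𝟎 , 𝟎∈ , sym (trans (cong (_⊕ 𝟎) (0-· r)) (⊕-identityˡ 𝟎))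
  span-∷ {r} (⊕∈ p p′) with span-∷ p | span-∷ p′
  ... | β , s , ps , e | β′ , s′ , ps′ , e′ = β +ᶠ β′ , s ⊕ s′ , ⊕∈ ps ps′ ,
        trans (cong₂ _⊕_ e e′) (trans (⊕-interchange _ _ _ _) (cong (_⊕ (s ⊕ s′)) (sym (+-distrib-· β β′ r))))
  span-∷ {r} (·∈ a p) with span-∷ p
  ... | β , s , ps , e = a *ᶠ β , a · s , ·∈ a ps ,
        trans (cong (a ·_) e) (trans (·-distrib-⊕ a _ _) (cong (_⊕ (a · s)) (sym (*-assoc-· a β r))))

  InSpan : ∀ {d} → Vec V d → V → Set
  InSpan {d} b v = Σ (Vec Carrier d) λ c → v ≡ lincomb c b

  generator⇒lincomb : ∀ {d} (b : Vec V d) {v} → v ∈ Vec.toList b → InSpan b v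
  generator⇒lincomb (x ∷ b) (here refl) =
    (1# ∷ replicate _ 0#) , sym (trans (cong₂ _⊕_ (1-· x) (lincomb-zero b)) (⊕-identityʳ x))
  generator⇒lincomb (x ∷ b) (there m) with generator⇒lincomb b m
  ... | c , e = (0# ∷ c) , trans e (sym (trans (cong (_⊕ lincomb c b) (0-· x)) (⊕-identityˡ _)))

  span⇒lincomb : ∀ {d} (b : Vec V d) {v} → Span (Vec.toList b) v → InSpan b v
  span⇒lincomb b (generator m) = generator⇒lincomb b m
  span⇒lincomb b 𝟎∈            = replicate _ 0# , sym (lincomb-zero b)
  span⇒lincomb b (⊕∈ p p′) with span⇒lincomb b p | span⇒lincomb b p′
  ... | c , e | c′ , e′ = zipWith _+ᶠ_ c c′ , trans (cong₂ _⊕_ e e′) (sym (lincomb-+ c c′ b))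
  span⇒lincomb b (·∈ a p) with span⇒lincomb b p
  ... | c , e = map (a *ᶠ_) c , trans (cong (a ·_) e) (sym (lincomb-· a c b))

  lincomb∈span : ∀ {d} (c : Vec Carrier d) (b : Vec V d) → Span (Vec.toList b) (lincomb c b)
  lincomb∈span []      []      = 𝟎∈
  lincomb∈span (a ∷ c) (x ∷ b) = ⊕∈ (·∈ a (generator (here refl))) (span-mono there (lincomb∈span c b))

  lincomb⇒span : ∀ {d} (b : Vec V d) {v} → InSpan b v → Span (Vec.toList b) v
  lincomb⇒span b (c , refl) = lincomb∈span c b

  Independent : List V → Set
  Independent []      = ⊤
  Independent (w ∷ I) = ¬ Span I w × Independent I

  linIndep⇒independent : ∀ {d} (b : Vec V d) → LinIndep b → Independent (Vec.toList b)
  linIndep⇒independent []      _           = tt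
  linIndep⇒independent (w ∷ b) independent = w∉span , linIndep⇒independent b tail-independent
    where
    tail-independent : LinIndep b
    tail-independent c e = cong Vec.tail (independent (0# ∷ c) (trans (cong₂ _⊕_ (0-· w) e) (⊕-identityˡ 𝟎)))
    -1≢0 : ¬ (-ᶠ 1# ≡ 0#)
    -1≢0 e = 0≢1 (sym (trans (sym (+-identityʳ 1#)) (trans (cong (1# +ᶠ_) (sym e)) (-‿inverseʳ 1#))))
    -- w = Σ cᵢbᵢ gives the nontrivial relation (−1)·w + Σ cᵢbᵢ = 0
    w∉span : ¬ Span (Vec.toList b) w
    w∉span p with span⇒lincomb b p
    ... | c , w≡cb = -1≢0 (cong Vec.head (independent ((-ᶠ 1#) ∷ c)
            (trans (cong (((-ᶠ 1#) · w) ⊕_) (sym w≡cb)) (trans (⊕-comm _ _) (⊕-cancel w)))))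

  solve-for : ∀ {β β⁻¹ r s w} → β *ᶠ β⁻¹ ≡ 1# → w ≡ (β · r) ⊕ s → β⁻¹ · (w ⊕ ((-ᶠ 1#) · s)) ≡ r
  solve-for {β} {β⁻¹} {r} {s} {w} ββ⁻¹≡1 w≡βr+s = begin
    β⁻¹ · (w ⊕ ((-ᶠ 1#) · s))               ≡⟨ cong (λ z → β⁻¹ · (z ⊕ ((-ᶠ 1#) · s))) w≡βr+s ⟩
    β⁻¹ · (((β · r) ⊕ s) ⊕ ((-ᶠ 1#) · s))   ≡⟨ cong (β⁻¹ ·_) (⊕-assoc _ _ _) ⟩
    β⁻¹ · ((β · r) ⊕ (s ⊕ ((-ᶠ 1#) · s)))   ≡⟨ cong (λ z → β⁻¹ · ((β · r) ⊕ z)) (⊕-cancel s) ⟩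
    β⁻¹ · ((β · r) ⊕ 𝟎)                     ≡⟨ cong (β⁻¹ ·_) (⊕-identityʳ _) ⟩
    β⁻¹ · (β · r)                           ≡⟨ sym (*-assoc-· β⁻¹ β r) ⟩
    (β⁻¹ *ᶠ β) · r                          ≡⟨ cong (_· r) (trans (*-comm β⁻¹ β) ββ⁻¹≡1) ⟩
    1# · r                                  ≡⟨ 1-· r ⟩
    r ∎

  drop-zero-term : ∀ {β r s w} → β ≡ 0# → w ≡ (β · r) ⊕ s → w ≡ s
  drop-zero-term {β} {r} {s} β≡0 w≡βr+s =
    trans w≡βr+s (trans (cong (λ z → (z · r) ⊕ s) β≡0) (trans (cong (_⊕ s) (0-· r)) (⊕-identityˡ s)))

  to-front : ∀ (A : List V) {x r : V} {R : List V} → x ∈ A ++ r ∷ R → x ∈ r ∷ (A ++ R)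
  to-front A m with ∈-++⁻ A m
  ... | inj₁ m′         = there (∈-++⁺ˡ m′)
  ... | inj₂ (here e)   = here e
  ... | inj₂ (there m′) = there (∈-++⁺ʳ A m′)

  insert : ∀ {w} (A : List V) {x r : V} {R : List V} → x ∈ w ∷ A ++ R → x ∈ w ∷ A ++ r ∷ R
  insert A (here e)  = here e
  insert A (there m) = there ([ ∈-++⁺ˡ , (λ m′ → ∈-++⁺ʳ A (there m′)) ]′ (∈-++⁻ A m))

  exchange-step : (A R′ : List V) {w : V} → Span (A ++ R′) w → ¬ Span A w →
                  Σ (List V) λ R → (suc (length R) ≡ length R′) × (∀ {x} → x ∈ R′ → Span (w ∷ A ++ R) x)
  exchange-step A [] w∈ w∉ = ⊥-elim (w∉ (subst (λ L → Span L _) (Listₚ.++-identityʳ A) w∈))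
  exchange-step A (r ∷ R′) {w} w∈ w∉ with span-∷ (span-mono (to-front A) w∈)
  ... | β , s , s∈ , w≡βr+s with β ≟ᶠ 0#
  ...   | yes β≡0 with exchange-step A R′ (subst (Span (A ++ R′)) (sym (drop-zero-term β≡0 w≡βr+s)) s∈) w∉
  ...     | R , shorter , R′⊆ = r ∷ R , cong suc shorter , cover
    where
    -- w does not need r: keep r, and let w replace a vector of R′
    cover : ∀ {x} → x ∈ r ∷ R′ → Span (w ∷ A ++ r ∷ R) x
    cover (here refl) = generator (there (∈-++⁺ʳ A (here refl)))
    cover (there m)   = span-mono (insert A) (R′⊆ m)
  exchange-step A (r ∷ R′) {w} w∈ w∉ | β , s , s∈ , w≡βr+s | no β≢0 with inverse β β≢0
  ...     | β⁻¹ , ββ⁻¹≡1 = R′ , refl , cover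
    where
    -- r is recovered from w and the rest, so w replaces r
    cover : ∀ {x} → x ∈ r ∷ R′ → Span (w ∷ A ++ R′) x
    cover (here refl) = subst (Span (w ∷ A ++ R′)) (solve-for ββ⁻¹≡1 w≡βr+s)
                              (·∈ β⁻¹ (⊕∈ (generator (here refl)) (·∈ (-ᶠ 1#) (span-mono there s∈))))
    cover (there m)   = generator (there (∈-++⁺ʳ A m))

  exchange : (I S : List V) → Independent I → (∀ {x} → x ∈ I → Span S x) →
             Σ (List V) λ R → (length I + length R ≡ length S) × (∀ {x} → x ∈ S → Span (I ++ R) x)
  exchange []      S _               _    = S , refl , generator
  exchange (w ∷ I) S (w∉ , I-indep) I⊆S with exchange I S I-indep (λ m → I⊆S (there m))
  ... | R′ , sizes′ , S⊆I+R′ with exchange-step I R′ (span-trans S⊆I+R′ (I⊆S (here refl))) w∉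
  ... | R , shorter , R′⊆ = R , sizes , (λ m → span-trans swap-in (S⊆I+R′ m))
    where
    sizes : suc (length I + length R) ≡ length S
    sizes = trans (sym (ℕₚ.+-suc (length I) (length R))) (trans (cong (length I +_) shorter) sizes′)
    swap-in : ∀ {y} → y ∈ I ++ R′ → Span (w ∷ I ++ R) y
    swap-in m with ∈-++⁻ I m
    ... | inj₁ m∈I  = generator (there (∈-++⁺ˡ m∈I))
    ... | inj₂ m∈R′ = R′⊆ m∈R′

  steinitz : (I S : List V) → Independent I → (∀ {x} → x ∈ I → Span S x) → length I ≤ length S
  steinitz I S I-indep I⊆S with exchange I S I-indep I⊆S
  ... | R , sizes , _ = subst (length I ≤_) sizes (ℕₚ.m≤m+n _ _)

  basis-spans : ∀ {P : V → Set} {d} (h : HasDimP P d) {x} → P x → Span (Vec.toList (proj₁ h)) x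
  basis-spans (b , _ , P⇔span) {x} x∈P = lincomb⇒span b (Equivalence.to (P⇔span x) x∈P)

  basis-∈ : ∀ {P : V → Set} {d} (h : HasDimP P d) {x} → x ∈ Vec.toList (proj₁ h) → P x
  basis-∈ (b , _ , P⇔span) {x} m = Equivalence.from (P⇔span x) (generator⇒lincomb b m)

  length-basis : ∀ {P : V → Set} {d} (h : HasDimP P d) → length (Vec.toList (proj₁ h)) ≡ d
  length-basis h = Vecₚ.length-toList (proj₁ h)

  private
    distance-arithmetic : ∀ a b k r r′ δ → δ ≤ a ∸ b → k ≤ b → a ≤ k + (r + r′) →
                          δ ≤ ((k + r) + (k + r′) ∸ k) ∸ k
    distance-arithmetic a b k r r′ δ δ≤a-b k≤b a≤ =
      ℕₚ.≤-trans δ≤a-b (ℕₚ.≤-trans (ℕₚ.∸-monoʳ-≤ a k≤b)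
        (ℕₚ.≤-trans (ℕₚ.∸-monoˡ-≤ k a≤) (ℕₚ.≤-reflexive (trans (ℕₚ.m+n∸m≡n k (r + r′)) (sym cancel)))))
      where
      regroup : ∀ k r r′ → (k + r) + (k + r′) ≡ k + (k + (r + r′))
      regroup = solve-∀
      cancel : ((k + r) + (k + r′) ∸ k) ∸ k ≡ r + r′
      cancel rewrite regroup k r r′ | ℕₚ.m+n∸m≡n k (k + (r + r′)) = ℕₚ.m+n∸m≡n k (r + r′)

  -- Subspaces of dimensions s and t sharing an independent list I have
  -- d_s(U,W) ≤ s + t − 2|I|: extend I to bases of U and W by exchange; their
  -- union spans U + W, so dim(U+W) ≤ s + t − |I|, while dim(U ∩ W) ≥ |I|.
  distance-bound : (U W : Subspace) (s t : ℕ) → HasDim U s → HasDim W t →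
                   (I : List V) → Independent I → (∀ {x} → x ∈ I → mem U x × mem W x) →
                   ∀ δ → DistAtLeast δ U W → δ ≤ (s + t ∸ length I) ∸ length I
  distance-bound U W s t hU hW I I-indep I⊆U∩W δ (a , b , hU+W , hU∩W , δ≤a-b)
    with exchange I (Vec.toList (proj₁ hU)) I-indep (λ m → basis-spans hU (proj₁ (I⊆U∩W m)))
       | exchange I (Vec.toList (proj₁ hW)) I-indep (λ m → basis-spans hW (proj₂ (I⊆U∩W m)))
  ... | RU , sizeU , U⊆ | RW , sizeW , W⊆ =
    subst₂ (λ s′ t′ → δ ≤ (s′ + t′ ∸ length I) ∸ length I)
           (trans sizeU (length-basis hU)) (trans sizeW (length-basis hW))
           (distance-arithmetic a b (length I) (length RU) (length RW) δ δ≤a-b |I|≤b a≤)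
    where
    |I|≤b : length I ≤ b
    |I|≤b = subst (length I ≤_) (length-basis hU∩W) (steinitz I _ I-indep (λ m → basis-spans hU∩W (I⊆U∩W m)))
    T : List V
    T = I ++ (RU ++ RW)
    U+W⊆T : ∀ {x} → x ∈ Vec.toList (proj₁ hU+W) → Span T x
    U+W⊆T m with basis-∈ hU+W m
    ... | u , w , u∈U , w∈W , refl = ⊕∈ (span-trans (λ m′ → span-mono into-T₁ (U⊆ m′)) (basis-spans hU u∈U))
                                        (span-trans (λ m′ → span-mono into-T₂ (W⊆ m′)) (basis-spans hW w∈W))
      where
      into-T₁ : ∀ {y} → y ∈ I ++ RU → y ∈ T
      into-T₁ m′ = [ ∈-++⁺ˡ , (λ r → ∈-++⁺ʳ I (∈-++⁺ˡ r)) ]′ (∈-++⁻ I m′)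
      into-T₂ : ∀ {y} → y ∈ I ++ RW → y ∈ T
      into-T₂ m′ = [ ∈-++⁺ˡ , (λ r → ∈-++⁺ʳ I (∈-++⁺ʳ RU r)) ]′ (∈-++⁻ I m′)
    a≤ : a ≤ length I + (length RU + length RW)
    a≤ = subst₂ _≤_ (length-basis hU+W) (trans (Listₚ.length-++ I) (cong (length I +_) (Listₚ.length-++ RU)))
           (steinitz _ T (linIndep⇒independent (proj₁ hU+W) (proj₁ (proj₂ hU+W))) U+W⊆T)

-- Counting vectors of F_q^7 and "flags" (u, v): u ≠ 0 and v ∉ ⟨u⟩, i.e. a
-- nonzero vector together with a vector completing it to a basis of a plane.
module FlagCounting {q : ℕ} (𝔽 : FiniteField q) where
  open FiniteField 𝔽 using (0#; enumeration)
  open Subspaces 𝔽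
  open FiniteSums
  open Enumerations
  open LinearAlgebra 𝔽
  open VecEnum fieldEnum using (enumVec; size-enumVec)

  vectorEnum : Enum V
  vectorEnum = enumVec 7

  open Enum vectorEnum public using () renaming (elems to vectors; _≟_ to _≟ᵛ_)

  # : {P : V → Set} → Decidable P → ℕ
  # P? = ∑ vectors (λ v → 𝟙 (P? v))

  size-field : Enum.size fieldEnum ≡ q
  size-field = size-enumVia q enumeration

  everything? : Decidable (λ (_ : V) → ⊤)
  everything? _ = yes tt

  size-V : # everything? ≡ q ^ 7
  size-V = trans (size-enumVec 7) (cong (_^ 7) size-field)

  ∑-complement : ∀ {f g h : V → ℕ} {c K} → (∀ v → f v + g v ≡ h v) →
                 ∑ vectors g ≡ c → ∑ vectors h ≡ K → ∑ vectors f ≡ K ∸ c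
  ∑-complement {f} {g} {h} {c} pointwise g≡c h≡K =
    trans (sym (ℕₚ.m+n∸n≡m _ c))
          (cong (_∸ c) (trans (cong (∑ vectors f +_) (sym g≡c))
                              (trans (sym (∑-+ vectors f g)) (trans (∑-cong vectors pointwise) h≡K))))

  inSpan? : ∀ {d} (b : Vec V d) → Decidable (InSpan b)
  inSpan? {d} b v = Enum.∃? (enumVec d) (λ c → v ≟ᵛ lincomb c b)

  size-span : ∀ {d} (b : Vec V d) → LinIndep b → # (inSpan? b) ≡ q ^ d
  size-span {d} b independent = begin
    ∑ vectors (λ v → 𝟙 (inSpan? b v))               ≡⟨ ∑-cong vectors (λ v → sym (ℕₚ.*-identityʳ _)) ⟩
    ∑ vectors (λ v → 𝟙 (inSpan? b v) * 1)           ≡⟨ ∑-image vectorEnum (enumVec d) (λ c → lincomb c b)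
                                                          (lincomb-injective b independent) (inSpan? b) (λ _ → 1) ⟩
    Enum.size (enumVec d)                           ≡⟨ size-enumVec d ⟩
    Enum.size fieldEnum ^ d                         ≡⟨ cong (_^ d) size-field ⟩
    q ^ d ∎
    where open ≡-Reasoning

  Line : V → V → Set
  Line u = InSpan (u ∷ [])

  𝟎∈span : ∀ {d} (b : Vec V d) → InSpan b 𝟎
  𝟎∈span b = replicate _ 0# , sym (lincomb-zero b)

  line⊆span : ∀ {d} (b : Vec V d) {u v} → InSpan b u → Line u v → InSpan b v
  line⊆span b u∈b v∈line =
    span⇒lincomb b (span-trans (λ { (here refl) → lincomb⇒span b u∈b }) (lincomb⇒span (_ ∷ []) v∈line))

  nonzero? : ∀ u → Dec (¬ u ≡ 𝟎)
  nonzero? u = ¬? (u ≟ᵛ 𝟎)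

  Flag : V → V → Set
  Flag u v = (¬ u ≡ 𝟎) × ¬ Line u v

  flag? : ∀ u v → Dec (Flag u v)
  flag? u v = nonzero? u ×-dec ¬? (inSpan? (u ∷ []) v)

  line-size : ∀ u → ¬ u ≡ 𝟎 → # (inSpan? (u ∷ [])) ≡ q
  line-size u u≢𝟎 = trans (size-span (u ∷ []) independent) (ℕₚ.*-identityʳ q)
    where
    independent : LinIndep (u ∷ [])
    independent (a ∷ []) au≡𝟎 = cong (_∷ []) (scalar-kills⇒zero a u (trans (sym (⊕-identityʳ _)) au≡𝟎) u≢𝟎)

  count-nonzero : ∀ {P : V → Set} (P? : Decidable P) {K} → # P? ≡ K → P 𝟎 →
                  ∑ vectors (λ u → 𝟙 (P? u) * 𝟙 (nonzero? u)) ≡ K ∸ 1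
  count-nonzero P? #P≡K 𝟎∈P = ∑-complement pointwise (Enum.once vectorEnum 𝟎) #P≡K
    where
    pointwise : ∀ u → 𝟙 (P? u) * 𝟙 (nonzero? u) + 𝟙 (u ≟ᵛ 𝟎) ≡ 𝟙 (P? u)
    pointwise u with u ≟ᵛ 𝟎
    ... | yes refl rewrite 𝟙-yes (P? 𝟎) 𝟎∈P = refl
    ... | no u≢𝟎   = trans (ℕₚ.+-identityʳ _) (ℕₚ.*-identityʳ _)

  count-off-line : ∀ {Q : V → Set} (Q? : Decidable Q) {M} → # Q? ≡ M →
                   ∀ u → ¬ u ≡ 𝟎 → (∀ v → Line u v → Q v) →
                   ∑ vectors (λ v → 𝟙 (Q? v) * 𝟙 (flag? u v)) ≡ M ∸ q
  count-off-line Q? #Q≡M u u≢𝟎 line⊆Q = ∑-complement pointwise (line-size u u≢𝟎) #Q≡M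
    where
    pointwise : ∀ v → 𝟙 (Q? v) * 𝟙 (flag? u v) + 𝟙 (inSpan? (u ∷ []) v) ≡ 𝟙 (Q? v)
    pointwise v = split (inSpan? (u ∷ []) v)
      where
      split : (d : Dec (Line u v)) → 𝟙 (Q? v) * 𝟙 (flag? u v) + 𝟙 d ≡ 𝟙 (Q? v)
      split (yes v∈line) rewrite 𝟙-yes (Q? v) (line⊆Q v v∈line) | 𝟙-no (flag? u v) (λ flag → proj₂ flag v∈line) = refl
      split (no v∉line)  rewrite 𝟙-yes (flag? u v) (u≢𝟎 , v∉line) = trans (ℕₚ.+-identityʳ _) (ℕₚ.*-identityʳ _)

  flags-at : ∀ {Q : V → Set} (Q? : Decidable Q) {M} → # Q? ≡ M → ∀ u → (∀ v → Line u v → Q v) →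
             ∑ vectors (λ v → 𝟙 (Q? v) * 𝟙 (flag? u v)) ≡ 𝟙 (nonzero? u) * (M ∸ q)
  flags-at Q? {M} #Q≡M u line⊆Q = split (nonzero? u)
    where
    split : (d : Dec (¬ u ≡ 𝟎)) → ∑ vectors (λ v → 𝟙 (Q? v) * 𝟙 (flag? u v)) ≡ 𝟙 d * (M ∸ q)
    split (yes u≢𝟎) = trans (count-off-line Q? #Q≡M u u≢𝟎 line⊆Q) (sym (ℕₚ.+-identityʳ _))
    split (no u≡𝟎)  = ∑-zero vectors (λ v → trans (cong (𝟙 (Q? v) *_) (𝟙-no (flag? u v) (λ flag → u≡𝟎 (proj₁ flag))))
                                                   (ℕₚ.*-zeroʳ (𝟙 (Q? v))))

  -- Flags (u, v) with u ∈ P and v ∈ Q, where |P| = K, 0 ∈ P, |Q| = M and Q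
  -- contains every line through a point of P: (K − 1) choices of u, then M − q of v.
  count-flags : ∀ {P Q : V → Set} (P? : Decidable P) (Q? : Decidable Q) {K M} →
                # P? ≡ K → # Q? ≡ M → P 𝟎 → (∀ u v → P u → Line u v → Q v) →
                ∑ vectors (λ u → ∑ vectors (λ v → 𝟙 (P? u) * (𝟙 (Q? v) * 𝟙 (flag? u v)))) ≡ (K ∸ 1) * (M ∸ q)
  count-flags P? Q? {K} {M} #P≡K #Q≡M 𝟎∈P lines⊆Q = begin
    ∑ vectors (λ u → ∑ vectors (λ v → 𝟙 (P? u) * (𝟙 (Q? v) * 𝟙 (flag? u v))))
      ≡⟨ ∑-cong vectors (λ u → trans (∑-*ˡ vectors _ (𝟙 (P? u))) (flags-in-P u)) ⟩
    ∑ vectors (λ u → 𝟙 (P? u) * 𝟙 (nonzero? u) * (M ∸ q))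
      ≡⟨ ∑-*ʳ vectors _ (M ∸ q) ⟩
    ∑ vectors (λ u → 𝟙 (P? u) * 𝟙 (nonzero? u)) * (M ∸ q)
      ≡⟨ cong (_* (M ∸ q)) (count-nonzero P? #P≡K 𝟎∈P) ⟩
    (K ∸ 1) * (M ∸ q) ∎
    where
    open ≡-Reasoning
    flags-in-P : ∀ u → 𝟙 (P? u) * ∑ vectors (λ v → 𝟙 (Q? v) * 𝟙 (flag? u v)) ≡ 𝟙 (P? u) * 𝟙 (nonzero? u) * (M ∸ q)
    flags-in-P u with P? u
    ... | no _    = refl
    ... | yes u∈P = trans (cong (1 *_) (flags-at Q? #Q≡M u (λ v → lines⊆Q u v u∈P)))
                          (sym (ℕₚ.*-assoc 1 (𝟙 (nonzero? u)) (M ∸ q)))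

-- The double count: every flag is charged to at most one codeword.
module DoubleCounting {q : ℕ} (𝔽 : FiniteField q) where
  open Subspaces 𝔽
  open FiniteSums
  open Enumerations
  open LinearAlgebra 𝔽
  open FlagCounting 𝔽
  open Arithmetic
  all-flags : ∑ vectors (λ u → ∑ vectors (λ v → 𝟙 (flag? u v))) ≡ pairs q
  all-flags = trans (∑-cong vectors (λ u → ∑-cong vectors (λ v → sym (1*1* (𝟙 (flag? u v))))))
                    (count-flags everything? everything? size-V size-V tt (λ _ _ _ _ → tt))
    where
    1*1* : ∀ x → 1 * (1 * x) ≡ x
    1*1* x = trans (ℕₚ.*-identityˡ (1 * x)) (ℕₚ.*-identityˡ x)

  charge : ∀ d → Vec V d → V → V → ℕ
  charge 2 b u v = 𝟙 (inSpan? b u) * (𝟙 (everything? v) * 𝟙 (flag? u v))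
  charge 3 b u v = 𝟙 (inSpan? b u) * (𝟙 (inSpan? b v) * 𝟙 (flag? u v))
  charge _ _ _ _ = 0

  weight : ℕ → ℕ
  weight 2 = pairsPlane q
  weight 3 = pairsSolid q
  weight _ = 0

  total-charge : ∀ d (b : Vec V d) → LinIndep b → ∑ vectors (λ u → ∑ vectors (λ v → charge d b u v)) ≡ weight d
  total-charge 2 b independent =
    count-flags (inSpan? b) everything? (size-span b independent) size-V (𝟎∈span b) (λ _ _ _ _ → tt)
  total-charge 3 b independent =
    count-flags (inSpan? b) (inSpan? b) (size-span b independent) (size-span b independent) (𝟎∈span b)
                (λ u v → line⊆span b)
  total-charge 0 b _ = ∑-zero vectors (λ u → ∑-zero vectors (λ v → refl))
  total-charge 1 b _ = ∑-zero vectors (λ u → ∑-zero vectors (λ v → refl))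
  total-charge (suc (suc (suc (suc d)))) b _ = ∑-zero vectors (λ u → ∑-zero vectors (λ v → refl))

  weight-split : ∀ d → weight d ≡ pairsPlane q * 𝟙 (d ℕ.≟ 2) + pairsSolid q * 𝟙 (d ℕ.≟ 3)
  weight-split 0 = sym (cong₂ _+_ (ℕₚ.*-zeroʳ (pairsPlane q)) (ℕₚ.*-zeroʳ (pairsSolid q)))
  weight-split 1 = sym (cong₂ _+_ (ℕₚ.*-zeroʳ (pairsPlane q)) (ℕₚ.*-zeroʳ (pairsSolid q)))
  weight-split 2 = sym (trans (cong₂ _+_ (ℕₚ.*-identityʳ (pairsPlane q)) (ℕₚ.*-zeroʳ (pairsSolid q)))
                              (ℕₚ.+-identityʳ (pairsPlane q)))
  weight-split 3 = sym (cong₂ _+_ (ℕₚ.*-zeroʳ (pairsPlane q)) (ℕₚ.*-identityʳ (pairsSolid q)))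
  weight-split (suc (suc (suc (suc d)))) = sym (cong₂ _+_ (ℕₚ.*-zeroʳ (pairsPlane q)) (ℕₚ.*-zeroʳ (pairsSolid q)))

  charge≤flag : ∀ d (b : Vec V d) u v → charge d b u v ≤ 𝟙 (flag? u v)
  charge≤flag 0 b u v = z≤n
  charge≤flag 1 b u v = z≤n
  charge≤flag 2 b u v = ℕₚ.≤-trans (𝟙*≤ (inSpan? b u) _) (𝟙*≤ (everything? v) _)
  charge≤flag 3 b u v = ℕₚ.≤-trans (𝟙*≤ (inSpan? b u) _) (𝟙*≤ (inSpan? b v) _)
  charge≤flag (suc (suc (suc (suc d)))) b u v = z≤n

  Charged : ∀ d → Vec V d → V → V → Set
  Charged d b u v = Flag u v × InSpan b u × ((d ≡ 2) ⊎ ((d ≡ 3) × InSpan b v))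

  charge-positive : ∀ d (b : Vec V d) u v → 1 ≤ charge d b u v → Charged d b u v
  charge-positive 2 b u v h with 𝟙*-positive (inSpan? b u) _ h
  ... | u∈b , h′ = 𝟙-positive (flag? u v) (proj₂ (𝟙*-positive (everything? v) _ h′)) , u∈b , inj₁ refl
  charge-positive 3 b u v h with 𝟙*-positive (inSpan? b u) _ h
  ... | u∈b , h′ with 𝟙*-positive (inSpan? b v) _ h′
  ... | v∈b , h″ = 𝟙-positive (flag? u v) h″ , u∈b , inj₂ (refl , v∈b)

  -- Two codewords charged with the same flag (u, v) are at distance < 4: they
  -- share u, and if both are solids they share the independent pair v, u.
  shared-flag⇒close : (U W : Subspace) {s t : ℕ} (hU : HasDim U s) (hW : HasDim W t) {u v : V} →
                      Charged s (proj₁ hU) u v → Charged t (proj₁ hW) u v → ¬ DistAtLeast 4 U W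
  shared-flag⇒close U W {s} {t} hU hW {u} {v} ((u≢𝟎 , v∉line) , u∈U , roleU) (_ , u∈W , roleW) far = by-roles roleU roleW
    where
    in-U : ∀ {x} → InSpan (proj₁ hU) x → mem U x
    in-U {x} = Equivalence.from (proj₂ (proj₂ hU) x)
    in-W : ∀ {x} → InSpan (proj₁ hW) x → mem W x
    in-W {x} = Equivalence.from (proj₂ (proj₂ hW) x)
    u-independent : Independent (u ∷ [])
    u-independent = (λ u∈⟨⟩ → u≢𝟎 (span-[] u∈⟨⟩)) , tt
    u-shared : ∀ {x} → x ∈ u ∷ [] → mem U x × mem W x
    u-shared (here refl) = in-U u∈U , in-W u∈W
    below-4 : ∀ {n} → n ≤ 3 → ¬ 4 ≤ n
    below-4 n≤3 4≤n = ℕₚ.<-irrefl refl (ℕₚ.≤-trans 4≤n n≤3)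
    by-roles : (s ≡ 2) ⊎ ((s ≡ 3) × InSpan (proj₁ hU) v) → (t ≡ 2) ⊎ ((t ≡ 3) × InSpan (proj₁ hW) v) → ⊥
    by-roles (inj₁ refl) (inj₁ refl) = below-4 (s≤s (s≤s z≤n)) (distance-bound U W 2 2 hU hW _ u-independent u-shared 4 far)
    by-roles (inj₁ refl) (inj₂ (refl , _)) = below-4 ℕₚ.≤-refl (distance-bound U W 2 3 hU hW _ u-independent u-shared 4 far)
    by-roles (inj₂ (refl , _)) (inj₁ refl) = below-4 ℕₚ.≤-refl (distance-bound U W 3 2 hU hW _ u-independent u-shared 4 far)
    by-roles (inj₂ (refl , v∈U)) (inj₂ (refl , v∈W)) =
      below-4 (s≤s (s≤s z≤n)) (distance-bound U W 3 3 hU hW (v ∷ u ∷ []) vu-independent vu-shared 4 far)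
      where
      vu-independent : Independent (v ∷ u ∷ [])
      vu-independent = (λ v∈⟨u⟩ → v∉line (span⇒lincomb (u ∷ []) v∈⟨u⟩)) , u-independent
      vu-shared : ∀ {x} → x ∈ v ∷ u ∷ [] → mem U x × mem W x
      vu-shared (here refl) = in-U v∈U , in-W v∈W
      vu-shared (there m)   = u-shared m

  module _ {n : ℕ} (C : Fin n → Codeword) (minDist : MinDist C 4) where

    basis : ∀ i → Vec V (dim (C i))
    basis i = proj₁ (hasDim (C i))

    charge-of : Fin n → V → V → ℕ
    charge-of i = charge (dim (C i)) (basis i)

    charged-at-most-once : ∀ u v → ∑ (allFin n) (λ i → charge-of i u v) ≤ 𝟙 (flag? u v)
    charged-at-most-once u v = Enum.∑-at-most-one (enumFin n) (λ i → charge-of i u v) _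
                                 (λ i → charge≤flag _ (basis i) u v) unique
      where
      unique : ∀ i j → 1 ≤ charge-of i u v → 1 ≤ charge-of j u v → i ≡ j
      unique i j i-charged j-charged with i Finₚ.≟ j
      ... | yes i≡j = i≡j
      ... | no i≢j  = ⊥-elim (shared-flag⇒close (space (C i)) (space (C j)) (hasDim (C i)) (hasDim (C j))
                               (charge-positive _ (basis i) u v i-charged) (charge-positive _ (basis j) u v j-charged)
                               (minDist i j i≢j))

    charges-by-codeword : ∑ (allFin n) (λ i → ∑ vectors (λ u → ∑ vectors (λ v → charge-of i u v)))
                          ≡ pairsPlane q * count C 2 + pairsSolid q * count C 3
    charges-by-codeword = begin
      ∑ (allFin n) (λ i → ∑ vectors (λ u → ∑ vectors (λ v → charge-of i u v)))
        ≡⟨ ∑-cong (allFin n) (λ i → trans (total-charge _ (basis i) (proj₁ (proj₂ (hasDim (C i))))) (weight-split (dim (C i)))) ⟩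
      ∑ (allFin n) (λ i → pairsPlane q * 𝟙 (dim (C i) ℕ.≟ 2) + pairsSolid q * 𝟙 (dim (C i) ℕ.≟ 3))
        ≡⟨ ∑-+ (allFin n) _ _ ⟩
      ∑ (allFin n) (λ i → pairsPlane q * 𝟙 (dim (C i) ℕ.≟ 2)) + ∑ (allFin n) (λ i → pairsSolid q * 𝟙 (dim (C i) ℕ.≟ 3))
        ≡⟨ cong₂ _+_ (weighted-count 2 (pairsPlane q)) (weighted-count 3 (pairsSolid q)) ⟩
      pairsPlane q * count C 2 + pairsSolid q * count C 3 ∎
      where
      open ≡-Reasoning
      weighted-count : ∀ k w → ∑ (allFin n) (λ i → w * 𝟙 (dim (C i) ℕ.≟ k)) ≡ w * count C k
      weighted-count k w = trans (∑-*ˡ (allFin n) _ w) (cong (w *_) (sym (length-filter _ (allFin n))))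

    flag-double-count : pairsPlane q * count C 2 + pairsSolid q * count C 3 ≤ pairs q
    flag-double-count = begin
      pairsPlane q * count C 2 + pairsSolid q * count C 3
        ≡⟨ sym charges-by-codeword ⟩
      ∑ (allFin n) (λ i → ∑ vectors (λ u → ∑ vectors (λ v → charge-of i u v)))
        ≡⟨ ∑-swap (allFin n) vectors _ ⟩
      ∑ vectors (λ u → ∑ (allFin n) (λ i → ∑ vectors (λ v → charge-of i u v)))
        ≡⟨ ∑-cong vectors (λ u → ∑-swap (allFin n) vectors _) ⟩
      ∑ vectors (λ u → ∑ vectors (λ v → ∑ (allFin n) (λ i → charge-of i u v)))
        ≤⟨ ∑-mono vectors (λ u → ∑-mono vectors (charged-at-most-once u)) ⟩
      ∑ vectors (λ u → ∑ vectors (λ v → 𝟙 (flag? u v)))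
        ≡⟨ all-flags ⟩
      pairs q ∎
      where open ℕₚ.≤-Reasoning

prime-power≥2 : ∀ {q} → IsPrimePower q → 2 ≤ q
prime-power≥2 (p , k , p-prime , 1≤k , refl) =
  ℕₚ.≤-trans (ℕ.nonTrivial⇒n>1 p {{prime⇒nonTrivial p-prime}})
             (ℕₚ.≤-trans (ℕₚ.≤-reflexive (sym (ℕₚ.*-identityʳ p))) (ℕₚ.^-monoʳ-≤ p 1≤k))
  where instance _ = prime⇒nonZero p-prime

lemma9 : (q : ℕ) → IsPrimePower q → (𝔽 : FiniteField q) → (n : ℕ)
    → (C : Fin n → Subspaces.Codeword 𝔽) → Subspaces.MinDist 𝔽 C 4
    → let x = Subspaces.count 𝔽 C
          bound = (q * q ∸ q + 1) * gauss1 7 q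
      in (x 2 + x 3 ≤ bound) × (x 2 + x 3 ≡ bound → x 2 ≡ 0)
lemma9 q prime-power 𝔽 n C minDist =
  Arithmetic.pair-count-bound q (prime-power≥2 prime-power) (count C 2) (count C 3)
    (DoubleCounting.flag-double-count 𝔽 C minDist)
  where open Subspaces 𝔽 using (count)
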